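{- Let $O$ and $F$ be two vertices of a (possibly degenerate) $2\times n$ transportation polytope, identified with their support graphs in $K_{2,n}$. Then either $|O\setminus F|\leq n-1$, or $|O\setminus F|=n$ and $|F|=n$.
   Context: $P=\{y\in\mathbb{R}^{2\times n}: \sum_j y_{ij}=u_i,\ \sum_i y_{ij}=v_j,\ y\ge 0\}$ with positive margins. The support graph of a point $y$ is the subgraph of the complete bipartite graph $K_{2,n}$ (supply nodes $\mathfrak{s}_1,\mathfrak{s}_2$, demand nodes $\mathfrak{d}_1,\ldots,\mathfrak{d}_n$) with edge set $\{\{\mathfrak{s}_i,\mathfrak{d}_j\}: y_{ij}>0\}$; $|O|$ is its number of edges and $O\setminus F$ is the set of edges of the support graph of $O$ not in that of $F$. (Vertices of $P$ are exactly the points whose support graph is a forest.)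
   Formalization: The margins are rational and the polytope is taken in ℚ^(2×n) rather than $\mathbb{R}^{2\times n}$, so the vertices $O$ and $F$ and the points tested for extremality have rational entries. -}

module Defs where

open import Data.Nat using (ℕ; zero; suc)
open import Data.Fin using (Fin; zero; suc)
open import Data.Rational using (ℚ; 0ℚ; 1ℚ; _+_; _*_; _-_; _≤_; _<_)
open import Data.Rational.Properties using (_<?_)
open import Data.Product using (_×_)
open import Relation.Nullary using (¬_; does)
open import Data.Bool using (Bool; true; false; not; _∧_; if_then_else_)
open import Relation.Binary.PropositionalEquality using (_≡_)

Σℚ : ∀ {m} → (Fin m → ℚ) → ℚ
Σℚ {zero}  f = 0ℚ
Σℚ {suc m} f = f zero + Σℚ (λ j → f (suc j))

count : ∀ {m} → (Fin m → Bool) → ℕ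
count {zero}  p = 0
count {suc m} p = (if p zero then 1 else 0) Data.Nat.+ count (λ j → p (suc j))

Mat : ℕ → Set
Mat n = Fin 2 → Fin n → ℚ

InP : ∀ {n} → (Fin 2 → ℚ) → (Fin n → ℚ) → Mat n → Set
InP {n} u v y =
  (∀ i → Σℚ (λ j → y i j) ≡ u i) ×
  (∀ j → Σℚ (λ i → y i j) ≡ v j) ×
  (∀ i j → 0ℚ ≤ y i j)

IsVertex : ∀ {n} → (Fin 2 → ℚ) → (Fin n → ℚ) → Mat n → Set
IsVertex {n} u v y =
  InP u v y ×
  (∀ (y₁ y₂ : Mat n) (t : ℚ) → InP u v y₁ → InP u v y₂ →
     0ℚ < t → t < 1ℚ →
     (∀ i j → y i j ≡ t * y₁ i j + (1ℚ - t) * y₂ i j) →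
     ∀ i j → y₁ i j ≡ y₂ i j)

inSupp : ∀ {n} → Mat n → Fin 2 → Fin n → Bool
inSupp y i j = does (0ℚ <? y i j)

countEdges : ∀ {n} → (Fin 2 → Fin n → Bool) → ℕ
countEdges p = count (p zero) Data.Nat.+ count (p (suc zero))

edges : ∀ {n} → Mat n → ℕ
edges O = countEdges (inSupp O)

edgeDiff : ∀ {n} → Mat n → Mat n → ℕ
edgeDiff O F = countEdges (λ i j → inSupp O i j ∧ not (inSupp F i j))

{-# OPTIONS --safe #-}
-- Since every demand v_j is positive, every column of F carries an edge of F.
-- Edges of O ∖ F avoid F, so column j contributes at most 2 − |F ∩ column j|
-- edges to O ∖ F. Summing over the columns,
-- |O ∖ F| + |F| ≤ 2n while |F| ≥ n, and both alternatives follow.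
module Submission where

open import Defs
open import Data.Nat using (ℕ; _≤_; _∸_; _+_; zero; suc; s≤s; z≤n)
open import Data.Nat.Properties
  using (≤-trans; ≤-reflexive; ≤-antisym; +-suc; +-monoʳ-≤; +-mono-≤; n≤1+n; m≤n⇒m≤1+n;
         +-cancelˡ-≤; +-cancelʳ-≤; m≤n⇒m<n∨m≡n; suc[m]≤n⇒m≤pred[n]; +-commutativeSemigroup;
         module ≤-Reasoning)
open import Algebra.Properties.CommutativeSemigroup +-commutativeSemigroup using (interchange)
open import Data.Fin using (Fin; zero; suc)
open import Data.Rational using (ℚ; 0ℚ; _<_)
import Data.Rational as ℚ
import Data.Rational.Properties as ℚ
open import Data.Bool using (Bool; true; false; not; _∧_; _∨_)
open import Data.Bool.Properties using (∧-assoc; ∧-inverseˡ; ∧-zeroʳ; ∨-zeroʳ)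
open import Data.Sum using (_⊎_; inj₁; inj₂)
open import Data.Product using (_×_; _,_)
open import Function using (_∘_)
open import Data.Empty using (⊥-elim)
open import Relation.Nullary using (yes; no)
open import Relation.Nullary.Decidable using (dec-true)
open import Relation.Binary.PropositionalEquality using (_≡_; refl; sym; trans; cong; subst; module ≡-Reasoning)

count-disjoint-≤ : ∀ {m} (p q : Fin m → Bool) →
  (∀ j → p j ∧ q j ≡ false) → count p + count q ≤ m
count-disjoint-≤ {zero}  p q disjoint = z≤n
count-disjoint-≤ {suc m} p q disjoint
  with count-disjoint-≤ (p ∘ suc) (q ∘ suc) (disjoint ∘ suc) | p zero | q zero | disjoint zero
... | ih | true  | false | _ = s≤s ih
... | ih | false | true  | _ = ≤-trans (≤-reflexive (+-suc _ _)) (s≤s ih)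
... | ih | false | false | _ = m≤n⇒m≤1+n ih

count-covering-≥ : ∀ {m} (p q : Fin m → Bool) →
  (∀ j → p j ∨ q j ≡ true) → m ≤ count p + count q
count-covering-≥ {zero}  p q covering = z≤n
count-covering-≥ {suc m} p q covering
  with count-covering-≥ (p ∘ suc) (q ∘ suc) (covering ∘ suc) | p zero | q zero | covering zero
... | ih | true  | true  | _ = s≤s (≤-trans ih (+-monoʳ-≤ _ (n≤1+n _)))
... | ih | true  | false | _ = s≤s ih
... | ih | false | true  | _ = ≤-trans (s≤s ih) (≤-reflexive (sym (+-suc _ _)))

∧-not-∧-false : ∀ a b → (a ∧ not b) ∧ b ≡ false
∧-not-∧-false a b = begin
  (a ∧ not b) ∧ b ≡⟨ ∧-assoc a (not b) b ⟩
  a ∧ (not b ∧ b) ≡⟨ cong (a ∧_) (∧-inverseˡ b) ⟩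
  a ∧ false       ≡⟨ ∧-zeroʳ a ⟩
  false           ∎
  where open ≡-Reasoning

edgeDiff+edges≤n+n : ∀ {n} (O F : Mat n) → edgeDiff O F + edges F ≤ n + n
edgeDiff+edges≤n+n {n} O F = begin
  edgeDiff O F + edges F
    ≡⟨ interchange (count (outside zero)) (count (outside (suc zero)))
                   (count (inSupp F zero)) (count (inSupp F (suc zero))) ⟩
  (count (outside zero) + count (inSupp F zero)) +
  (count (outside (suc zero)) + count (inSupp F (suc zero)))
    ≤⟨ +-mono-≤ (row-bound zero) (row-bound (suc zero)) ⟩
  n + n ∎
  where
  open ≤-Reasoning
  outside : Fin 2 → Fin n → Bool
  outside i j = inSupp O i j ∧ not (inSupp F i j)
  row-bound : ∀ i → count (outside i) + count (inSupp F i) ≤ n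
  row-bound i = count-disjoint-≤ (outside i) (inSupp F i)
                  (λ j → ∧-not-∧-false (inSupp O i j) (inSupp F i j))

column-supported : ∀ {n} {u : Fin 2 → ℚ} {v : Fin n → ℚ} {F : Mat n} →
  (∀ j → 0ℚ < v j) → InP u v F → ∀ j → inSupp F zero j ∨ inSupp F (suc zero) j ≡ true
column-supported {v = v} {F = F} v>0 (_ , columnSums , _) j
  with 0ℚ ℚ.<? F zero j | 0ℚ ℚ.<? F (suc zero) j
... | yes F₀>0 | _        = cong (_∨ inSupp F (suc zero) j) (dec-true (0ℚ ℚ.<? F zero j) F₀>0)
... | no _     | yes F₁>0 = trans (cong (inSupp F zero j ∨_) (dec-true (0ℚ ℚ.<? F (suc zero) j) F₁>0))
                                (∨-zeroʳ (inSupp F zero j))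
... | no ≯₀    | no ≯₁    = ⊥-elim (ℚ.<-irrefl refl (ℚ.<-≤-trans (v>0 j) v≤0))
  where
  v≤0 : v j ℚ.≤ 0ℚ
  v≤0 = subst (ℚ._≤ 0ℚ) (columnSums j) (ℚ.+-mono-≤ (ℚ.≮⇒≥ ≯₀) (ℚ.+-mono-≤ (ℚ.≮⇒≥ ≯₁) ℚ.≤-refl))

m+n≤o+o∧o≤n⇒m≤o∸1⊎m≡o×n≡o : ∀ {m n o} → m + n ≤ o + o → o ≤ n → m ≤ o ∸ 1 ⊎ (m ≡ o × n ≡ o)
m+n≤o+o∧o≤n⇒m≤o∸1⊎m≡o×n≡o {m} {n} {o} m+n≤o+o o≤n
  with m≤n⇒m<n∨m≡n (+-cancelʳ-≤ o m o (≤-trans (+-monoʳ-≤ m o≤n) m+n≤o+o))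
... | inj₁ m<o  = inj₁ (suc[m]≤n⇒m≤pred[n] m<o)
... | inj₂ refl = inj₂ (refl , ≤-antisym (+-cancelˡ-≤ m n m m+n≤o+o) o≤n)

lemma4 : (n : ℕ) (u : Fin 2 → ℚ) (v : Fin n → ℚ) →
    (∀ i → 0ℚ < u i) → (∀ j → 0ℚ < v j) →
    (O F : Mat n) → IsVertex u v O → IsVertex u v F →
    edgeDiff O F ≤ n ∸ 1 ⊎ (edgeDiff O F ≡ n × edges F ≡ n)
lemma4 n u v _ v>0 O F _ (F∈P , _) =
  m+n≤o+o∧o≤n⇒m≤o∸1⊎m≡o×n≡o (edgeDiff+edges≤n+n O F) n≤edges
  where
  n≤edges : n ≤ edges F
  n≤edges = count-covering-≥ (inSupp F zero) (inSupp F (suc zero)) (column-supported v>0 F∈P)
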